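{- (1) $\mathtt{Log}(\mathcal{C}_{\mathbf{ref}})=\mathtt{Log}(\mathcal{C}_{\mathbf{uref}}\cap\mathcal{C}_{\mathbf{dref}})$; (2) $\mathtt{Log}(\mathcal{C}_{\mathbf{sym}})=\mathtt{Log}(\mathcal{C}_{\mathbf{usym}}\cap\mathcal{C}_{\mathbf{dsym}})$; (3) $\mathtt{Log}(\mathcal{C}_{\mathbf{tra}})=\mathtt{Log}(\mathcal{C}_{\mathbf{all}})$; (4) $\mathtt{Log}(\mathcal{C}_{\mathbf{ref}}\cap\mathcal{C}_{\mathbf{sym}})=\mathtt{Log}(\mathcal{C}_{\mathbf{uref}}\cap\mathcal{C}_{\mathbf{dref}}\cap\mathcal{C}_{\mathbf{usym}}\cap\mathcal{C}_{\mathbf{dsym}})$; (5) $\mathtt{Log}(\mathcal{C}_{\mathbf{ref}}\cap\mathcal{C}_{\mathbf{tra}})=\mathtt{Log}(\mathcal{C}_{\mathbf{uref}}\cap\mathcal{C}_{\mathbf{dref}})$; (6) $\mathtt{Log}(\mathcal{C}_{\mathbf{par}})=\mathtt{Log}(\mathcal{C}_{\mathbf{uref}}\cap\mathcal{C}_{\mathbf{dref}}\cap\mathcal{C}_{\mathbf{usym}}\cap\mathcal{C}_{\mathbf{dsym}})$.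
   Context: Formulas are built from a countably infinite set of atoms by $A::=p\mid (A\rightarrow A)\mid\top\mid\bot\mid(A\vee A)\mid(A\wedge A)\mid\square A\mid\lozenge A$. A frame is a triple $(W,\leq,R)$ with $W$ nonempty, $\leq$ a preorder on $W$, $R$ a binary relation on $W$; $\geq$ is the converse of $\leq$, and $s(S\circ T)t$ means there is $u$ with $sSu$ and $uTt$. A valuation assigns to each atom a $\leq$-upward-closed subset of $W$. Satisfaction: $s\models p$ iff $s\in V(p)$; $s\models A\rightarrow B$ iff for all $t\geq s$, $t\models A$ implies $t\models B$; $\top$ always true, $\bot$ never; $\vee,\wedge$ pointwise; $s\models\square A$ iff $t\models A$ for all $t$ with $s(\leq\circ R)t$; $s\models\lozenge A$ iff there is $t$ with $s(\geq\circ R)t$ and $t\models A$. A formula is valid in a frame if true at every state of every model based on it; $\mathtt{Log}(\mathcal{C})$ is the set of formulas valid in all frames of $\mathcal{C}$. Classes: $\mathcal{C}_{\mathbf{all}}$ all frames; $\mathcal{C}_{\mathbf{ref}}$, $\mathcal{C}_{\mathbf{sym}}$, $\mathcal{C}_{\mathbf{tra}}$: frames with $R$ reflexive, symmetric, transitive; $\mathcal{C}_{\mathbf{par}}$: $R$ reflexive, symmetric and transitive; $\mathcal{C}_{\mathbf{uref}}$: for all $s$, $s(\leq\circ R\circ\leq)s$; $\mathcal{C}_{\mathbf{dref}}$: for all $s$, $s(\geq\circ R\circ\geq)s$; $\mathcal{C}_{\mathbf{usym}}$: $sRt$ implies $t(\leq\circ R\circ\leq)s$; $\mathcal{C}_{\mathbf{dsym}}$: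 $sRt$ implies $t(\geq\circ R\circ\geq)s$. -}

module Defs where

open import Data.Nat using (ℕ)
open import Data.Product using (Σ; ∃; _×_; _,_)
open import Data.Sum using (_⊎_)
open import Data.Unit using (⊤)
open import Data.Empty using (⊥)
open import Function.Bundles using (_⇔_)
open import Level using (Lift; lift)

data Form : Set where
  atom : ℕ → Form
  _⇒_  : Form → Form → Form
  ⊤̇ ⊥̇  : Form
  _∨̇_ _∧̇_ : Form → Form → Form
  □ ◇  : Form → Form

record Frame : Set₁ where
  field
    W      : Set
    inhabitant : W
    _≤_    : W → W → Set
    ≤-refl : ∀ {s} → s ≤ s
    ≤-trans : ∀ {s t u} → s ≤ t → t ≤ u → s ≤ u
    R      : W → W → Set

open Frame public

_⨾_ : {W : Set} → (W → W → Set) → (W → W → Set) → W → W → Set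
(S ⨾ T) s t = ∃ λ u → S s u × T u t

_ᶜ : {W : Set} → (W → W → Set) → W → W → Set
(S ᶜ) s t = S t s

record Valuation (F : Frame) : Set₁ where
  field
    V      : ℕ → W F → Set
    upward : ∀ p {s t} → _≤_ F s t → V p s → V p t

open Valuation public

_,_⊨_ : {F : Frame} → Valuation F → W F → Form → Set
_,_⊨_ {F} M s (atom p) = V M p s
_,_⊨_ {F} M s (A ⇒ B) = ∀ t → _≤_ F s t → M , t ⊨ A → M , t ⊨ B
_,_⊨_ {F} M s ⊤̇ = ⊤
_,_⊨_ {F} M s ⊥̇ = ⊥
_,_⊨_ {F} M s (A ∨̇ B) = (M , s ⊨ A) ⊎ (M , s ⊨ B)
_,_⊨_ {F} M s (A ∧̇ B) = (M , s ⊨ A) × (M , s ⊨ B)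
_,_⊨_ {F} M s (□ A) = ∀ t → (_≤_ F ⨾ R F) s t → M , t ⊨ A
_,_⊨_ {F} M s (◇ A) = ∃ λ t → ((_≤_ F ᶜ) ⨾ R F) s t × M , t ⊨ A

ValidIn : Frame → Form → Set₁
ValidIn F A = (M : Valuation F) → (s : W F) → M , s ⊨ A

FrameClass : Set₂
FrameClass = Frame → Set₁

Log : FrameClass → Form → Set₁
Log C A = (F : Frame) → C F → ValidIn F A

SameLogic : FrameClass → FrameClass → Set₁
SameLogic C D = (A : Form) → Log C A ⇔ Log D A

_∩_ : FrameClass → FrameClass → FrameClass
(C ∩ D) F = C F × D F

infixr 6 _∩_

cls : (Frame → Set) → FrameClass
cls P F = Lift _ (P F)

Call Cref Csym Ctra Cpar Curef Cdref Cusym Cdsym : FrameClass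
Call F = Lift _ ⊤
Cref = cls λ F → ∀ s → R F s s
Csym = cls λ F → ∀ s t → R F s t → R F t s
Ctra = cls λ F → ∀ s t u → R F s t → R F t u → R F s u
Cpar = cls λ F → (∀ s → R F s s) × (∀ s t → R F s t → R F t s)
                 × (∀ s t u → R F s t → R F t u → R F s u)
Curef = cls λ F → ∀ s → (_≤_ F ⨾ (R F ⨾ _≤_ F)) s s
Cdref = cls λ F → ∀ s → ((_≤_ F ᶜ) ⨾ (R F ⨾ (_≤_ F ᶜ))) s s
Cusym = cls λ F → ∀ s t → R F s t → (_≤_ F ⨾ (R F ⨾ _≤_ F)) t s
Cdsym = cls λ F → ∀ s t → R F s t → ((_≤_ F ᶜ) ⨾ (R F ⨾ (_≤_ F ᶜ))) t s

-- Every frame F of the weaker class is the image of a reduction (a bounded morphism for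
-- the intuitionistic modal semantics) from a frame of the stronger class, and reductions
-- reflect validity.  The covering frame has a copy of each state of F and, for each R-edge
-- (a , t), a private two-point copy of that edge; relating these copies suitably makes R
-- reflexive, symmetric or transitive.  The covering maps onto F as long as every new step
-- lands on a Linked pair (reachable both by ≤;R;≤ and by ≥;R;≥), and uref, dref, usym and
-- dsym say exactly that the reflexive and converse steps are Linked.
module Submission where

open import Defs
open import Data.Bool.Base using (Bool; true; false; _<_; f<t; b≤b; f≤t)
  renaming (_≤_ to _≤ᵇ_)
open import Data.Bool.Properties using (<-trans) renaming (≤-refl to ≤ᵇ-refl; ≤-trans to ≤ᵇ-trans)
open import Data.Empty using (⊥; ⊥-elim)
open import Data.Product using (Σ; ∃; _×_; _,_; proj₁; proj₂)
open import Data.Sum using (_⊎_; inj₁; inj₂)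
open import Data.Unit using (⊤; tt)
open import Function.Base using (id; _∘_)
open import Function.Bundles using (mk⇔; Equivalence)
open import Level using (lift)
open import Relation.Binary.Definitions using (Reflexive; Symmetric; Transitive)
open import Relation.Binary.PropositionalEquality
  using (_≡_; _≢_; refl; sym; trans; ≢-sym)

⊨-upward : ∀ {F} (M : Valuation F) A {s t} → _≤_ F s t → M , s ⊨ A → M , t ⊨ A
⊨-upward M (atom p) s≤t h = upward M p s≤t h
⊨-upward {F} M (A ⇒ B) s≤t h u t≤u = h u (≤-trans F s≤t t≤u)
⊨-upward M ⊤̇ s≤t h = tt
⊨-upward M (A ∨̇ B) s≤t (inj₁ h) = inj₁ (⊨-upward M A s≤t h)
⊨-upward M (A ∨̇ B) s≤t (inj₂ h) = inj₂ (⊨-upward M B s≤t h)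
⊨-upward M (A ∧̇ B) s≤t (h , k) = ⊨-upward M A s≤t h , ⊨-upward M B s≤t k
⊨-upward {F} M (□ A) s≤t h u (v , t≤v , vRu) = h u (v , ≤-trans F s≤t t≤v , vRu)
⊨-upward {F} M (◇ A) s≤t (u , (v , v≤s , vRu) , hu) = u , (v , ≤-trans F v≤s s≤t , vRu) , hu

record Reduction (F′ F : Frame) : Set where
  field
    map       : W F′ → W F
    map-mono  : ∀ {x y} → _≤_ F′ x y → _≤_ F (map x) (map y)
    map-≤-back : ∀ x {t} → _≤_ F (map x) t → Σ (W F′) λ y → _≤_ F′ x y × map y ≡ t
    □-forth   : ∀ {x y} → (_≤_ F′ ⨾ R F′) x y → (_≤_ F ⨾ (R F ⨾ _≤_ F)) (map x) (map y)
    □-back    : ∀ x {t} → (_≤_ F ⨾ R F) (map x) t →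
                Σ (W F′) λ y → (_≤_ F′ ⨾ R F′) x y × _≤_ F (map y) t
    ◇-forth   : ∀ {x y} → ((_≤_ F′ ᶜ) ⨾ R F′) x y →
                ((_≤_ F ᶜ) ⨾ (R F ⨾ (_≤_ F ᶜ))) (map x) (map y)
    ◇-back    : ∀ x {t} → ((_≤_ F ᶜ) ⨾ R F) (map x) t →
                Σ (W F′) λ y → ((_≤_ F′ ᶜ) ⨾ R F′) x y × _≤_ F t (map y)
    map-surjective : ∀ s → ∃ λ x → map x ≡ s

module _ {F′ F : Frame} (ρ : Reduction F′ F) (M : Valuation F) where
  open Reduction ρ

  pullback : Valuation F′
  pullback = record { V = λ p x → V M p (map x) ; upward = λ p x≤y → upward M p (map-mono x≤y) }

  mutual
    ⊨-pullback→ : ∀ A x → pullback , x ⊨ A → M , map x ⊨ A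
    ⊨-pullback→ (atom p) x h = h
    ⊨-pullback→ (A ⇒ B) x h t x≤t ht with map-≤-back x x≤t
    ... | y , x≤y , refl = ⊨-pullback→ B y (h y x≤y (⊨-pullback← A y ht))
    ⊨-pullback→ ⊤̇ x h = tt
    ⊨-pullback→ (A ∨̇ B) x (inj₁ h) = inj₁ (⊨-pullback→ A x h)
    ⊨-pullback→ (A ∨̇ B) x (inj₂ h) = inj₂ (⊨-pullback→ B x h)
    ⊨-pullback→ (A ∧̇ B) x (h , k) = ⊨-pullback→ A x h , ⊨-pullback→ B x k
    ⊨-pullback→ (□ A) x h t step with □-back x step
    ... | y , x⇝y , y≤t = ⊨-upward M A y≤t (⊨-pullback→ A y (h y x⇝y))
    ⊨-pullback→ (◇ A) x (y , x⇝y , hy) with ◇-forth x⇝y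
    ... | a , a≤x , b , aRb , y≤b = b , (a , a≤x , aRb) , ⊨-upward M A y≤b (⊨-pullback→ A y hy)

    ⊨-pullback← : ∀ A x → M , map x ⊨ A → pullback , x ⊨ A
    ⊨-pullback← (atom p) x h = h
    ⊨-pullback← (A ⇒ B) x h y x≤y hy =
      ⊨-pullback← B y (h (map y) (map-mono x≤y) (⊨-pullback→ A y hy))
    ⊨-pullback← ⊤̇ x h = tt
    ⊨-pullback← (A ∨̇ B) x (inj₁ h) = inj₁ (⊨-pullback← A x h)
    ⊨-pullback← (A ∨̇ B) x (inj₂ h) = inj₂ (⊨-pullback← B x h)
    ⊨-pullback← (A ∧̇ B) x (h , k) = ⊨-pullback← A x h , ⊨-pullback← B x k
    ⊨-pullback← (□ A) x h y x⇝y with □-forth x⇝y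
    ... | a , x≤a , b , aRb , b≤y = ⊨-pullback← A y (⊨-upward M A b≤y (h b (a , x≤a , aRb)))
    ⊨-pullback← (◇ A) x (t , step , ht) with ◇-back x step
    ... | y , x⇝y , t≤y = y , x⇝y , ⊨-pullback← A y (⊨-upward M A t≤y ht)

reduction-reflects-validity : ∀ {F′ F} → Reduction F′ F → ∀ A → ValidIn F′ A → ValidIn F A
reduction-reflects-validity ρ A valid M s with Reduction.map-surjective ρ s
... | x , refl = ⊨-pullback→ ρ M A x (valid (pullback ρ M) x)

infix 4 _⊆_

_⊆_ : FrameClass → FrameClass → Set₁
C ⊆ D = ∀ F → C F → D F

Reducts : FrameClass → FrameClass
Reducts C F = Σ Frame λ F′ → C F′ × Reduction F′ F

Log-antitone : ∀ {C D} → C ⊆ D → ∀ A → Log D A → Log C A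
Log-antitone C⊆D A valid F CF = valid F (C⊆D F CF)

Log-Reducts : ∀ C A → Log C A → Log (Reducts C) A
Log-Reducts C A valid F (F′ , CF′ , ρ) = reduction-reflects-validity ρ A (valid F′ CF′)

sameLogic-byReducts : ∀ {C D} → C ⊆ D → D ⊆ Reducts C → SameLogic C D
sameLogic-byReducts {C} C⊆D D⊆RC A =
  mk⇔ (λ valid → Log-antitone D⊆RC A (Log-Reducts C A valid)) (Log-antitone C⊆D A)

sameLogic-sandwich : ∀ {C D E} → C ⊆ D → D ⊆ E → SameLogic C E → SameLogic D E
sameLogic-sandwich C⊆D D⊆E C≡E A =
  mk⇔ (λ valid → Equivalence.to (C≡E A) (Log-antitone C⊆D A valid)) (Log-antitone D⊆E A)

Linked : (F : Frame) → W F → W F → Set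
Linked F s t = (_≤_ F ⨾ (R F ⨾ _≤_ F)) s t × ((_≤_ F ᶜ) ⨾ (R F ⨾ (_≤_ F ᶜ))) s t

module _ (F : Frame) where
  R⇒Linked : ∀ {s t} → R F s t → Linked F s t
  R⇒Linked sRt = (_ , ≤-refl F , _ , sRt , ≤-refl F) , (_ , ≤-refl F , _ , sRt , ≤-refl F)

  Linked-refl : (Curef ∩ Cdref) F → ∀ s → Linked F s s
  Linked-refl (lift uref , lift dref) s = uref s , dref s

  Linked-converse : (Cusym ∩ Cdsym) F → ∀ {s t} → R F s t → Linked F t s
  Linked-converse (lift usym , lift dsym) sRt = usym _ _ sRt , dsym _ _ sRt

Cref⊆Curef∩Cdref : Cref ⊆ Curef ∩ Cdref
Cref⊆Curef∩Cdref F (lift reflR) =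
  lift (λ s → s , ≤-refl F , s , reflR s , ≤-refl F) , lift (λ s → s , ≤-refl F , s , reflR s , ≤-refl F)

Csym⊆Cusym∩Cdsym : Csym ⊆ Cusym ∩ Cdsym
Csym⊆Cusym∩Cdsym F (lift symR) =
  lift (λ s t sRt → t , ≤-refl F , s , symR s t sRt , ≤-refl F) ,
  lift (λ s t sRt → t , ≤-refl F , s , symR s t sRt , ≤-refl F)

-- Q relates the copies of the original states, B the two ends (false = source,
-- true = target) of the copy of an edge.
module Unfolding (F : Frame) (Q : W F → W F → Set) (B : Bool → Bool → Set) where
  Edge : Set
  Edge = Σ (W F) λ a → Σ (W F) λ t → R F a t

  endpoint : Edge → Bool → W F
  endpoint (a , _ , _) false = a
  endpoint (_ , t , _) true  = t

  Point : Set
  Point = W F ⊎ (Edge × Bool)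

  base : Point → W F
  base (inj₁ s) = s
  base (inj₂ (e , i)) = endpoint e i

  data _⟶_ : Point → Point → Set where
    inside : ∀ {a b} → Q a b → inj₁ a ⟶ inj₁ b
    along  : ∀ {e i j} → B i j → inj₂ (e , i) ⟶ inj₂ (e , j)

  unfolded : Frame
  unfolded = record
    { W = Point ; inhabitant = inj₁ (inhabitant F)
    ; _≤_ = λ x y → _≤_ F (base x) (base y) ; ≤-refl = ≤-refl F ; ≤-trans = ≤-trans F
    ; R = _⟶_ }

  ⟶-refl : Reflexive Q → Reflexive B → ∀ x → x ⟶ x
  ⟶-refl Q-refl B-refl (inj₁ _) = inside Q-refl
  ⟶-refl Q-refl B-refl (inj₂ _) = along B-refl

  ⟶-sym : Symmetric Q → Symmetric B → ∀ x y → x ⟶ y → y ⟶ x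
  ⟶-sym Q-sym B-sym _ _ (inside q) = inside (Q-sym q)
  ⟶-sym Q-sym B-sym _ _ (along b) = along (B-sym b)

  ⟶-trans : Transitive Q → Transitive B → ∀ x y z → x ⟶ y → y ⟶ z → x ⟶ z
  ⟶-trans Q-trans B-trans _ _ _ (inside q) (inside q′) = inside (Q-trans q q′)
  ⟶-trans Q-trans B-trans _ _ _ (along b) (along b′) = along (B-trans b b′)

  module _ (Q-linked : ∀ {a b} → Q a b → Linked F a b)
           (B-linked : ∀ {i j} → B i j → ∀ e → Linked F (endpoint e i) (endpoint e j))
           (B-forward : B false true) where

    ⟶-linked : ∀ {x y} → x ⟶ y → Linked F (base x) (base y)
    ⟶-linked (inside q) = Q-linked q
    ⟶-linked {inj₂ (e , _)} (along b) = B-linked b e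

    unfolded-reduction : Reduction unfolded F
    unfolded-reduction = record
      { map = base
      ; map-mono = id
      ; map-≤-back = λ x {t} x≤t → inj₁ t , x≤t , refl
      ; □-forth = λ { (y , x≤y , y⟶z) → let (c , y≤c , rest) = proj₁ (⟶-linked y⟶z)
                                          in c , ≤-trans F x≤y y≤c , rest }
      ; □-back = λ x {t} → λ { (a , x≤a , aRt) → edge-target a t aRt ,
                                (edge-source a t aRt , x≤a , along B-forward) , ≤-refl F }
      ; ◇-forth = λ { (y , y≤x , y⟶z) → let (c , c≤y , rest) = proj₂ (⟶-linked y⟶z)
                                          in c , ≤-trans F c≤y y≤x , rest }
      ; ◇-back = λ x {t} → λ { (a , a≤x , aRt) → edge-target a t aRt ,
                                (edge-source a t aRt , a≤x , along B-forward) , ≤-refl F }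
      ; map-surjective = λ s → inj₁ s , refl
      }
      where
      edge-source edge-target : ∀ a t → R F a t → Point
      edge-source a t aRt = inj₂ ((a , t , aRt) , false)
      edge-target a t aRt = inj₂ ((a , t , aRt) , true)

Call⊆Reducts[Ctra] : Call ⊆ Reducts Ctra
Call⊆Reducts[Ctra] F _ =
  unfolded , lift (⟶-trans (λ ()) <-trans) , unfolded-reduction (λ ()) ends-linked f<t
  where
  open Unfolding F (λ _ _ → ⊥) _<_
  ends-linked : ∀ {i j} → i < j → ∀ e → Linked F (endpoint e i) (endpoint e j)
  ends-linked f<t (_ , _ , aRt) = R⇒Linked F aRt

Cusym∩Cdsym⊆Reducts[Csym] : Cusym ∩ Cdsym ⊆ Reducts Csym
Cusym∩Cdsym⊆Reducts[Csym] F usym∩dsym =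
  unfolded , lift (⟶-sym (λ ()) ≢-sym) , unfolded-reduction (λ ()) ends-linked (λ ())
  where
  open Unfolding F (λ _ _ → ⊥) _≢_
  ends-linked : ∀ {i j} → i ≢ j → ∀ e → Linked F (endpoint e i) (endpoint e j)
  ends-linked {false} {false} i≢j _ = ⊥-elim (i≢j refl)
  ends-linked {false} {true}  _ (_ , _ , aRt) = R⇒Linked F aRt
  ends-linked {true}  {false} _ (_ , _ , aRt) = Linked-converse F usym∩dsym aRt
  ends-linked {true}  {true}  i≢j _ = ⊥-elim (i≢j refl)

Curef∩Cdref⊆Reducts[Cref∩Ctra] : Curef ∩ Cdref ⊆ Reducts (Cref ∩ Ctra)
Curef∩Cdref⊆Reducts[Cref∩Ctra] F uref∩dref =
  unfolded , (lift (⟶-refl refl ≤ᵇ-refl) , lift (⟶-trans trans ≤ᵇ-trans)) ,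
  unfolded-reduction (λ { refl → Linked-refl F uref∩dref _ }) ends-linked f≤t
  where
  open Unfolding F _≡_ _≤ᵇ_
  ends-linked : ∀ {i j} → i ≤ᵇ j → ∀ e → Linked F (endpoint e i) (endpoint e j)
  ends-linked {i} b≤b e = Linked-refl F uref∩dref (endpoint e i)
  ends-linked f≤t (_ , _ , aRt) = R⇒Linked F aRt

Curef∩Cdref∩Cusym∩Cdsym⊆Reducts[Cpar] : Curef ∩ Cdref ∩ Cusym ∩ Cdsym ⊆ Reducts Cpar
Curef∩Cdref∩Cusym∩Cdsym⊆Reducts[Cpar] F (uref , dref , usym∩dsym) =
  unfolded ,
  lift (⟶-refl refl tt , ⟶-sym sym (λ _ → tt) , ⟶-trans trans (λ _ _ → tt)) ,
  unfolded-reduction (λ { refl → Linked-refl F (uref , dref) _ }) (λ {i} {j} → ends-linked {i} {j}) tt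
  where
  open Unfolding F _≡_ (λ _ _ → ⊤)
  ends-linked : ∀ {i j} → ⊤ → ∀ e → Linked F (endpoint e i) (endpoint e j)
  ends-linked {false} {false} _ (a , _ , _)   = Linked-refl F (uref , dref) a
  ends-linked {false} {true}  _ (_ , _ , aRt) = R⇒Linked F aRt
  ends-linked {true}  {false} _ (_ , _ , aRt) = Linked-converse F usym∩dsym aRt
  ends-linked {true}  {true}  _ (_ , t , _)   = Linked-refl F (uref , dref) t

mainTheorem15 : SameLogic Cref (Curef ∩ Cdref)
    × SameLogic Csym (Cusym ∩ Cdsym)
    × SameLogic Ctra Call
    × SameLogic (Cref ∩ Csym) (Curef ∩ Cdref ∩ Cusym ∩ Cdsym)
    × SameLogic (Cref ∩ Ctra) (Curef ∩ Cdref)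
    × SameLogic Cpar (Curef ∩ Cdref ∩ Cusym ∩ Cdsym)
mainTheorem15 =
  sameLogic-sandwich (λ _ → proj₁) Cref⊆Curef∩Cdref refTra ,
  sameLogic-byReducts Csym⊆Cusym∩Cdsym Cusym∩Cdsym⊆Reducts[Csym] ,
  sameLogic-byReducts (λ _ _ → lift tt) Call⊆Reducts[Ctra] ,
  sameLogic-sandwich par⊆ref∩sym ref∩sym⊆weak par ,
  refTra ,
  par
  where
  refTra : SameLogic (Cref ∩ Ctra) (Curef ∩ Cdref)
  refTra = sameLogic-byReducts (λ F → Cref⊆Curef∩Cdref F ∘ proj₁) Curef∩Cdref⊆Reducts[Cref∩Ctra]

  ref∩sym⊆weak : Cref ∩ Csym ⊆ Curef ∩ Cdref ∩ Cusym ∩ Cdsym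
  ref∩sym⊆weak F (isRef , isSym) =
    let (uref , dref) = Cref⊆Curef∩Cdref F isRef in uref , dref , Csym⊆Cusym∩Cdsym F isSym

  par⊆ref∩sym : Cpar ⊆ Cref ∩ Csym
  par⊆ref∩sym F (lift (reflR , symR , _)) = lift reflR , lift symR

  par : SameLogic Cpar (Curef ∩ Cdref ∩ Cusym ∩ Cdsym)
  par = sameLogic-byReducts (λ F → ref∩sym⊆weak F ∘ par⊆ref∩sym F)
                            Curef∩Cdref∩Cusym∩Cdsym⊆Reducts[Cpar]
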